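{- If $\mathcal{M}$ is a Rayleigh matroid and $\mathcal{N}$ is a minor of $\mathcal{M}$, then $\mathcal{N}$ is a Rayleigh matroid.
   Context: For a matroid $\mathcal{M}$ on a finite ground set $E$ with indeterminates $\mathbf{y}=\{y_c: c\in E\}$ and disjoint $I,J\subseteq E$, put $M_I^J(\mathbf{y}):=\sum_{B}\prod_{c\in B\setminus I}y_c$, summed over all bases $B$ of $\mathcal{M}$ with $I\subseteq B$ and $B\cap J=\varnothing$ (abbreviations: $M_I=M_I^\varnothing$, $M^J=M^J_\varnothing$, $M_{ef}=M_{\{e,f\}}$, etc.). For distinct $e,f\in E$, $\Delta M\{e,f\}(\mathbf{y}):=M_e^fM_f^e-M_{ef}M^{ef}$. A matroid is Rayleigh if $\Delta M\{e,f\}(\mathbf{y})\ge 0$ for all distinct $e,f$ of its ground set whenever all $y_c>0$.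
   Formalization: In the Rayleigh condition the indeterminates $y_c$ are evaluated only at positive rationals. -}

module Defs where

open import Data.Bool using (Bool; true; false; _∧_; _∨_; not; if_then_else_; T)
open import Data.Nat using (ℕ; zero; suc)
open import Data.Fin using (Fin; zero; suc)
open import Data.Fin.Subset using (Subset; _∈_; _∉_; _∪_; ⁅_⁆; _⊆_; _∩_; ⊥) renaming (_-_ to _∖ₑ_)
open import Data.Vec using (Vec; []; _∷_; lookup; insertAt)
open import Data.List using (List; []; _∷_; map; _++_; filter; foldr)
open import Data.Product using (Σ; _×_; _,_; ∃-syntax)
open import Data.Rational using (ℚ; 0ℚ; 1ℚ; _+_; _*_; _-_; _≤_; _<_)
open import Relation.Binary.PropositionalEquality using (_≡_; _≢_)

-- Ground set E = Fin n; subsets of E are Data.Fin.Subset.Subset n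
-- (Vec Bool n, true = inside).

allSubsets : (n : ℕ) → List (Subset n)
allSubsets zero    = [] ∷ []
allSubsets (suc n) = map (true ∷_) (allSubsets n) ++ map (false ∷_) (allSubsets n)

anyᴸ : {A : Set} → (A → Bool) → List A → Bool
anyᴸ p = foldr (λ x b → p x ∨ b) false

_⊆ᵇ_ : {n : ℕ} → Subset n → Subset n → Bool
[] ⊆ᵇ [] = true
(true  ∷ I) ⊆ᵇ (b ∷ B) = b ∧ (I ⊆ᵇ B)
(false ∷ I) ⊆ᵇ (b ∷ B) = I ⊆ᵇ B

disjointᵇ : {n : ℕ} → Subset n → Subset n → Bool
disjointᵇ [] [] = true
disjointᵇ (b ∷ B) (j ∷ J) = not (b ∧ j) ∧ disjointᵇ B J

record Matroid (n : ℕ) : Set where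
  field
    isBasis  : Subset n → Bool
    nonempty : ∃[ B ] T (isBasis B)
    exchange : ∀ (B₁ B₂ : Subset n) → T (isBasis B₁) → T (isBasis B₂) →
               ∀ (x : Fin n) → x ∈ B₁ → x ∉ B₂ →
               ∃[ y ] (y ∈ B₂ × y ∉ B₁ × T (isBasis ((B₁ ∖ₑ x) ∪ ⁅ y ⁆)))
open Matroid public

prodOver : {n : ℕ} → Subset n → (Fin n → ℚ) → ℚ
prodOver []          y = 1ℚ
prodOver (true  ∷ S) y = y zero * prodOver S (λ i → y (suc i))
prodOver (false ∷ S) y = prodOver S (λ i → y (suc i))

sumᴸ : List ℚ → ℚ
sumᴸ = foldr _+_ 0ℚ

-- M_I^J(y) = Σ_{B basis, I ⊆ B, B ∩ J = ∅} ∏_{c ∈ B \ I} y_c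
polyM : {n : ℕ} → Matroid n → (I J : Subset n) → (Fin n → ℚ) → ℚ
polyM {n} M I J y =
  sumᴸ (map (λ B → if isBasis M B ∧ (I ⊆ᵇ B) ∧ disjointᵇ B J
                   then prodOver (B Data.Fin.Subset.─ I) y else 0ℚ)
            (allSubsets n))

ΔM : {n : ℕ} → Matroid n → (e f : Fin n) → (Fin n → ℚ) → ℚ
ΔM M e f y =
  polyM M ⁅ e ⁆ ⁅ f ⁆ y * polyM M ⁅ f ⁆ ⁅ e ⁆ y
  - polyM M (⁅ e ⁆ ∪ ⁅ f ⁆) ⊥ y * polyM M ⊥ (⁅ e ⁆ ∪ ⁅ f ⁆) y

-- Rayleigh: ΔM{e,f}(y) ≥ 0 for all distinct e,f whenever all y_c > 0
-- (indeterminates evaluated at positive rationals)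
Rayleigh : {n : ℕ} → Matroid n → Set
Rayleigh {n} M = ∀ (e f : Fin n) → e ≢ f → ∀ (y : Fin n → ℚ) →
  (∀ c → 0ℚ < y c) → 0ℚ ≤ ΔM M e f y

-- Deletion and contraction of an element i of Fin (suc n), acting on
-- basis families; the remaining ground set E ∖ {i} is identified with
-- Fin n via insertAt (i.e. punchIn).

Family : ℕ → Set
Family n = Subset n → Bool

-- M \ i : if i is a coloop (every basis contains i) the bases are B − i
-- for bases B; otherwise the bases of M avoiding i.
delete : {n : ℕ} → Family (suc n) → Fin (suc n) → Family n
delete {n} β i S =
  if anyᴸ (λ B → β B ∧ not (lookup B i)) (allSubsets (suc n))
  then β (insertAt S i false)
  else β (insertAt S i true)

-- M / i : if i is a loop (no basis contains i) same as deletion;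
-- otherwise B − i for bases B containing i.
contract : {n : ℕ} → Family (suc n) → Fin (suc n) → Family n
contract {n} β i S =
  if anyᴸ (λ B → β B ∧ lookup B i) (allSubsets (suc n))
  then β (insertAt S i true)
  else β (insertAt S i false)

data IsMinorFam : {m n : ℕ} → Family m → Family n → Set where
  here : ∀ {n} {β' β : Family n} → (∀ S → β' S ≡ β S) → IsMinorFam β' β
  del  : ∀ {m n} {β' : Family m} {β : Family (suc n)} (i : Fin (suc n)) →
         IsMinorFam β' (delete β i) → IsMinorFam β' β
  con  : ∀ {m n} {β' : Family m} {β : Family (suc n)} (i : Fin (suc n)) →
         IsMinorFam β' (contract β i) → IsMinorFam β' β

IsMinor : {m n : ℕ} → Matroid m → Matroid n → Set
IsMinor N M = IsMinorFam (isBasis N) (isBasis M)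

-- Put y_i = t. Splitting the bases according to whether they contain i turns ΔM{e,f}
-- (for e, f ≠ i) into (a₁ + t c₁)(a₂ + t c₂) − (a₃ + t c₃)(a₄ + t c₄), where the aₖ are the
-- polynomials of the bases avoiding i and the cₖ those of the bases containing i. A quadratic
-- in t that is nonnegative for all t > 0 has nonnegative constant and leading coefficients,
-- and these are exactly the Rayleigh differences of the two families. Deleting or contracting
-- i keeps one of the two families (which one depends on whether i is a loop or coloop), so
-- the Rayleigh property passes to single-element minors, hence to all minors.

module Submission where

open import Data.Bool using (Bool; true; false; _∧_; not; if_then_else_)
open import Data.Fin using (Fin; zero; suc; punchIn)
open import Data.Fin.Properties using (punchIn-injective)
open import Data.Fin.Subset using (Subset; ⁅_⁆; _∪_; ⊥; _─_)
open import Data.List using (List; []; _∷_; map; _++_)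
open import Data.List.Properties using (map-∘; map-cong)
open import Data.Nat using (ℕ; zero; suc)
open import Data.Product using (_×_; _,_; proj₁; proj₂)
open import Data.Rational
  using (ℚ; 0ℚ; _+_; _*_; _-_; -_; _≤_; _<_; ∣_∣; 1/_; NonZero; positive; negative; nonNegative)
open import Data.Rational.Properties
open import Data.Rational.Solver using (module +-*-Solver)
open import Data.Sum using (inj₁; inj₂)
open import Data.Vec using (Vec; []; _∷_; insertAt; lookup; zipWith; replicate)
import Data.Vec.Functional as Vector
open import Function using (_∘_)
open import Relation.Binary.PropositionalEquality
open import Relation.Nullary using (¬_)

open import Defs

open +-*-Solver

private
  0<* : ∀ {p q} → 0ℚ < p → 0ℚ < q → 0ℚ < p * q
  0<* {p} {q} 0<p 0<q = positive⁻¹ (p * q) {{pos*pos⇒pos p {{positive 0<p}} q {{positive 0<q}}}}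

  0≤* : ∀ {p q} → 0ℚ ≤ p → 0ℚ ≤ q → 0ℚ ≤ p * q
  0≤* {p} {q} 0≤p 0≤q =
    nonNegative⁻¹ (p * q) {{nonNeg*nonNeg⇒nonNeg p {{nonNegative 0≤p}} q {{nonNegative 0≤q}}}}

  p≤∣p∣ : ∀ p → p ≤ ∣ p ∣
  p≤∣p∣ p with ≤-total 0ℚ p
  ... | inj₁ 0≤p = ≤-reflexive (sym (0≤p⇒∣p∣≡p 0≤p))
  ... | inj₂ p≤0 = ≤-trans p≤0 (0≤∣p∣ p)

quadForm : (A B C x y : ℚ) → ℚ
quadForm A B C x y = A * (y * y) + B * (x * y) + C * (x * x)

NonNegOnPositives : (ℚ → ℚ → ℚ) → Set
NonNegOnPositives Q = ∀ x y → 0ℚ < x → 0ℚ < y → 0ℚ ≤ Q x y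

-- At x = -A and y = -A + ∣B∣ + ∣C∣ the form is at most -A²y, which is negative when A is.
0≤quadForm⇒0≤A : ∀ A B C → NonNegOnPositives (quadForm A B C) → 0ℚ ≤ A
0≤quadForm⇒0≤A A B C nonNeg = ≮⇒≥ A≮0
  where
  A≮0 : ¬ (A < 0ℚ)
  A≮0 A<0 = <-irrefl refl (≤-<-trans (nonNeg x y 0<x 0<y) Q<0)
    where
    open ≤-Reasoning
    x = - A
    y = x + ∣ B ∣ + ∣ C ∣
    0<x : 0ℚ < x
    0<x = neg-antimono-< A<0
    x≤y : x ≤ y
    x≤y = begin
      x                    ≡⟨ sym (+-identityʳ x) ⟩
      x + 0ℚ               ≤⟨ +-monoʳ-≤ x (+-mono-≤ (0≤∣p∣ B) (0≤∣p∣ C)) ⟩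
      x + (∣ B ∣ + ∣ C ∣)  ≡⟨ sym (+-assoc x ∣ B ∣ ∣ C ∣) ⟩
      y                    ∎
    0<y : 0ℚ < y
    0<y = <-≤-trans 0<x x≤y
    0≤x : 0ℚ ≤ x
    0≤x = <⇒≤ 0<x
    B-bound : B * (x * y) ≤ ∣ B ∣ * (x * y)
    B-bound = *-monoʳ-≤-nonNeg (x * y) {{nonNegative (0≤* 0≤x (<⇒≤ 0<y))}} (p≤∣p∣ B)
    C-bound : C * (x * x) ≤ ∣ C ∣ * (x * y)
    C-bound = begin
      C * (x * x)      ≤⟨ *-monoʳ-≤-nonNeg (x * x) {{nonNegative (0≤* 0≤x 0≤x)}} (p≤∣p∣ C) ⟩
      ∣ C ∣ * (x * x)  ≤⟨ *-monoˡ-≤-nonNeg ∣ C ∣ {{nonNegative (0≤∣p∣ C)}}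
                            (*-monoˡ-≤-nonNeg x {{nonNegative 0≤x}} x≤y) ⟩
      ∣ C ∣ * (x * y)  ∎
    0<AAy : 0ℚ < A * A * y
    0<AAy = 0<* (positive⁻¹ (A * A) {{neg*neg⇒pos A {{negative A<0}} A {{negative A<0}}}}) 0<y
    Q<0 : quadForm A B C x y < 0ℚ
    Q<0 = begin-strict
      quadForm A B C x y                              ≤⟨ +-mono-≤ (+-monoʳ-≤ (A * (y * y)) B-bound) C-bound ⟩
      A * (y * y) + ∣ B ∣ * (x * y) + ∣ C ∣ * (x * y)  ≡⟨ solve 3 (λ A b c →
        A :* (((:- A) :+ b :+ c) :* ((:- A) :+ b :+ c)) :+ b :* ((:- A) :* ((:- A) :+ b :+ c))
          :+ c :* ((:- A) :* ((:- A) :+ b :+ c))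
        := :- (A :* A :* ((:- A) :+ b :+ c))) refl A ∣ B ∣ ∣ C ∣ ⟩
      - (A * A * y)                                   <⟨ neg-antimono-< 0<AAy ⟩
      0ℚ                                              ∎

0≤quadForm⇒0≤C : ∀ A B C → NonNegOnPositives (quadForm A B C) → 0ℚ ≤ C
0≤quadForm⇒0≤C A B C nonNeg = 0≤quadForm⇒0≤A C B A λ x y 0<x 0<y →
  subst (0ℚ ≤_) (swap x y) (nonNeg y x 0<y 0<x)
  where
  swap : ∀ x y → quadForm A B C y x ≡ quadForm C B A x y
  swap = solve 5 (λ A B C x y → A :* (x :* x) :+ B :* (y :* x) :+ C :* (y :* y)
                            := C :* (y :* y) :+ B :* (x :* y) :+ A :* (x :* x)) refl A B C

0≤quadratic⇒0≤ends : ∀ A B C → (∀ t → 0ℚ < t → 0ℚ ≤ A + B * t + C * (t * t)) →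
  0ℚ ≤ A × 0ℚ ≤ C
0≤quadratic⇒0≤ends A B C nonNeg = 0≤quadForm⇒0≤A A B C 0≤Q , 0≤quadForm⇒0≤C A B C 0≤Q
  where
  0≤Q : NonNegOnPositives (quadForm A B C)
  0≤Q x y 0<x 0<y = subst (λ z → 0ℚ ≤ quadForm A B C z y) ty≡x
                      (subst (0ℚ ≤_) (dehomogenise t y) (0≤* (<⇒≤ (0<* 0<y 0<y)) (nonNeg t 0<t)))
    where
    instance
      y≢0 : NonZero y
      y≢0 = pos⇒nonZero y {{positive 0<y}}
    t = x * 1/ y
    0<t : 0ℚ < t
    0<t = 0<* 0<x (positive⁻¹ (1/ y) {{1/pos⇒pos y {{positive 0<y}}}})
    ty≡x : t * y ≡ x
    ty≡x = trans (*-assoc x (1/ y) y) (trans (cong (x *_) (*-inverseˡ y)) (*-identityʳ x))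
    dehomogenise : ∀ t y → y * y * (A + B * t + C * (t * t)) ≡ quadForm A B C (t * y) y
    dehomogenise = solve 5 (λ A B C t y → y :* y :* (A :+ B :* t :+ C :* (t :* t))
      := A :* (y :* y) :+ B :* ((t :* y) :* y) :+ C :* ((t :* y) :* (t :* y))) refl A B C

0≤pencil⇒0≤ends : ∀ a₁ a₂ a₃ a₄ c₁ c₂ c₃ c₄ →
  (∀ t → 0ℚ < t → 0ℚ ≤ (a₁ + t * c₁) * (a₂ + t * c₂) - (a₃ + t * c₃) * (a₄ + t * c₄)) →
  0ℚ ≤ a₁ * a₂ - a₃ * a₄ × 0ℚ ≤ c₁ * c₂ - c₃ * c₄
0≤pencil⇒0≤ends a₁ a₂ a₃ a₄ c₁ c₂ c₃ c₄ nonNeg =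
  0≤quadratic⇒0≤ends (a₁ * a₂ - a₃ * a₄) (a₁ * c₂ + c₁ * a₂ - a₃ * c₄ - c₃ * a₄)
                     (c₁ * c₂ - c₃ * c₄)
    (λ t 0<t → subst (0ℚ ≤_) (expand t) (nonNeg t 0<t))
  where
  expand : ∀ t → (a₁ + t * c₁) * (a₂ + t * c₂) - (a₃ + t * c₃) * (a₄ + t * c₄)
               ≡ (a₁ * a₂ - a₃ * a₄) + (a₁ * c₂ + c₁ * a₂ - a₃ * c₄ - c₃ * a₄) * t
                 + (c₁ * c₂ - c₃ * c₄) * (t * t)
  expand = solve 9 (λ a₁ a₂ a₃ a₄ c₁ c₂ c₃ c₄ t →
    (a₁ :+ t :* c₁) :* (a₂ :+ t :* c₂) :- (a₃ :+ t :* c₃) :* (a₄ :+ t :* c₄)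
    := (a₁ :* a₂ :- a₃ :* a₄) :+ (a₁ :* c₂ :+ c₁ :* a₂ :- a₃ :* c₄ :- c₃ :* a₄) :* t
       :+ (c₁ :* c₂ :- c₃ :* c₄) :* (t :* t)) refl a₁ a₂ a₃ a₄ c₁ c₂ c₃ c₄

sumOver : {A : Set} → List A → (A → ℚ) → ℚ
sumOver xs g = sumᴸ (map g xs)

sumOver-++ : ∀ {A : Set} (xs ys : List A) (g : A → ℚ) →
  sumOver (xs ++ ys) g ≡ sumOver xs g + sumOver ys g
sumOver-++ []       ys g = sym (+-identityˡ (sumOver ys g))
sumOver-++ (x ∷ xs) ys g =
  trans (cong (g x +_) (sumOver-++ xs ys g)) (sym (+-assoc (g x) (sumOver xs g) (sumOver ys g)))

sumOver-map : ∀ {A B : Set} (h : A → B) (xs : List A) (g : B → ℚ) →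
  sumOver (map h xs) g ≡ sumOver xs (g ∘ h)
sumOver-map h xs g = cong sumᴸ (sym (map-∘ xs))

sumOver-cong : ∀ {A : Set} (xs : List A) {g g′ : A → ℚ} → (∀ x → g x ≡ g′ x) →
  sumOver xs g ≡ sumOver xs g′
sumOver-cong xs g≗g′ = cong sumᴸ (map-cong g≗g′ xs)

sumOver-*ˡ : ∀ {A : Set} (t : ℚ) (xs : List A) (g : A → ℚ) →
  sumOver xs (λ x → t * g x) ≡ t * sumOver xs g
sumOver-*ˡ t []       g = sym (*-zeroʳ t)
sumOver-*ˡ t (x ∷ xs) g =
  trans (cong (t * g x +_) (sumOver-*ˡ t xs g)) (sym (*-distribˡ-+ t (g x) (sumOver xs g)))

sumOver-allSubsets-suc : ∀ {n} (g : Subset (suc n) → ℚ) →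
  sumOver (allSubsets (suc n)) g
    ≡ sumOver (allSubsets n) (g ∘ (true ∷_)) + sumOver (allSubsets n) (g ∘ (false ∷_))
sumOver-allSubsets-suc {n} g =
  trans (sumOver-++ (map (true ∷_) (allSubsets n)) (map (false ∷_) (allSubsets n)) g)
        (cong₂ _+_ (sumOver-map (true ∷_) (allSubsets n) g) (sumOver-map (false ∷_) (allSubsets n) g))

sumOver-allSubsets-insertAt : ∀ {n} (i : Fin (suc n)) (g : Subset (suc n) → ℚ) →
  sumOver (allSubsets (suc n)) g
    ≡ sumOver (allSubsets n) (λ S → g (insertAt S i false))
      + sumOver (allSubsets n) (λ S → g (insertAt S i true))
sumOver-allSubsets-insertAt {n} zero g =
  trans (sumOver-allSubsets-suc g) (+-comm (Σ (λ S → g (true ∷ S))) (Σ (λ S → g (false ∷ S))))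
  where
  Σ : (Subset n → ℚ) → ℚ
  Σ = sumOver (allSubsets n)
sumOver-allSubsets-insertAt {suc n} (suc i) g = begin
  sumOver (allSubsets (suc (suc n))) g
    ≡⟨ sumOver-allSubsets-suc g ⟩
  Σ (λ S → g (true ∷ S)) + Σ (λ S → g (false ∷ S))
    ≡⟨ cong₂ _+_ (sumOver-allSubsets-insertAt i (g ∘ (true ∷_)))
                 (sumOver-allSubsets-insertAt i (g ∘ (false ∷_))) ⟩
  (Σ′ (g ∘ (true ∷_) ∘ ins false) + Σ′ (g ∘ (true ∷_) ∘ ins true))
    + (Σ′ (g ∘ (false ∷_) ∘ ins false) + Σ′ (g ∘ (false ∷_) ∘ ins true))
    ≡⟨ interchange (Σ′ (g ∘ (true ∷_) ∘ ins false)) (Σ′ (g ∘ (true ∷_) ∘ ins true))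
                   (Σ′ (g ∘ (false ∷_) ∘ ins false)) (Σ′ (g ∘ (false ∷_) ∘ ins true)) ⟩
  (Σ′ (g ∘ (true ∷_) ∘ ins false) + Σ′ (g ∘ (false ∷_) ∘ ins false))
    + (Σ′ (g ∘ (true ∷_) ∘ ins true) + Σ′ (g ∘ (false ∷_) ∘ ins true))
    ≡⟨ sym (cong₂ _+_ (sumOver-allSubsets-suc (λ S → g (insertAt S (suc i) false)))
                      (sumOver-allSubsets-suc (λ S → g (insertAt S (suc i) true)))) ⟩
  Σ (λ S → g (insertAt S (suc i) false)) + Σ (λ S → g (insertAt S (suc i) true))
    ∎
  where
  open ≡-Reasoning
  Σ : (Subset (suc n) → ℚ) → ℚ
  Σ = sumOver (allSubsets (suc n))
  Σ′ : (Subset n → ℚ) → ℚ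
  Σ′ = sumOver (allSubsets n)
  ins : Bool → Subset n → Subset (suc n)
  ins b S = insertAt S i b
  interchange : ∀ a b c d → (a + b) + (c + d) ≡ (a + c) + (b + d)
  interchange = solve 4 (λ a b c d → (a :+ b) :+ (c :+ d) := (a :+ c) :+ (b :+ d)) refl

zipWith-insertAt : ∀ {A B C : Set} {n} (f : A → B → C) (xs : Vec A n) (ys : Vec B n)
  (i : Fin (suc n)) (x : A) (y : B) →
  zipWith f (insertAt xs i x) (insertAt ys i y) ≡ insertAt (zipWith f xs ys) i (f x y)
zipWith-insertAt f xs        ys        zero    x y = refl
zipWith-insertAt f (x′ ∷ xs) (y′ ∷ ys) (suc i) x y = cong (f x′ y′ ∷_) (zipWith-insertAt f xs ys i x y)

─-insertAt : ∀ {n} (i : Fin (suc n)) (S I : Subset n) b →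
  (insertAt S i b ─ insertAt I i false) ≡ insertAt (S ─ I) i b
─-insertAt i S I b = zipWith-insertAt _ S I i b false

replicate-insertAt : ∀ {A : Set} n (x : A) (i : Fin (suc n)) →
  insertAt (replicate n x) i x ≡ replicate (suc n) x
replicate-insertAt n       x zero    = refl
replicate-insertAt (suc n) x (suc i) = cong (x ∷_) (replicate-insertAt n x i)

⁅punchIn⁆ : ∀ {n} (i : Fin (suc n)) (e : Fin n) → ⁅ punchIn i e ⁆ ≡ insertAt ⁅ e ⁆ i false
⁅punchIn⁆ zero    e       = refl
⁅punchIn⁆ (suc i) zero    = cong (true ∷_) (sym (replicate-insertAt _ false i))
⁅punchIn⁆ (suc i) (suc e) = cong (false ∷_) (⁅punchIn⁆ i e)

⊆ᵇ-insertAt : ∀ {n} (i : Fin (suc n)) (I S : Subset n) b →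
  (insertAt I i false ⊆ᵇ insertAt S i b) ≡ (I ⊆ᵇ S)
⊆ᵇ-insertAt zero    I           S       b = refl
⊆ᵇ-insertAt (suc i) (true ∷ I)  (s ∷ S) b = cong (s ∧_) (⊆ᵇ-insertAt i I S b)
⊆ᵇ-insertAt (suc i) (false ∷ I) (s ∷ S) b = ⊆ᵇ-insertAt i I S b

disjointᵇ-insertAt : ∀ {n} (i : Fin (suc n)) (S J : Subset n) b →
  disjointᵇ (insertAt S i b) (insertAt J i false) ≡ disjointᵇ S J
disjointᵇ-insertAt zero    S       J       true  = refl
disjointᵇ-insertAt zero    S       J       false = refl
disjointᵇ-insertAt (suc i) (s ∷ S) (j ∷ J) b     = cong (not (s ∧ j) ∧_) (disjointᵇ-insertAt i S J b)

prodOver-insertAt-false : ∀ {n} (i : Fin (suc n)) (S : Subset n) (y : Fin n → ℚ) t →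
  prodOver (insertAt S i false) (Vector.insertAt y i t) ≡ prodOver S y
prodOver-insertAt-false zero    S           y t = refl
prodOver-insertAt-false (suc i) (true ∷ S)  y t = cong (y zero *_) (prodOver-insertAt-false i S (y ∘ suc) t)
prodOver-insertAt-false (suc i) (false ∷ S) y t = prodOver-insertAt-false i S (y ∘ suc) t

prodOver-insertAt-true : ∀ {n} (i : Fin (suc n)) (S : Subset n) (y : Fin n → ℚ) t →
  prodOver (insertAt S i true) (Vector.insertAt y i t) ≡ t * prodOver S y
prodOver-insertAt-true zero    S           y t = refl
prodOver-insertAt-true (suc i) (true ∷ S)  y t = begin
  y zero * prodOver (insertAt S i true) (Vector.insertAt (y ∘ suc) i t)
    ≡⟨ cong (y zero *_) (prodOver-insertAt-true i S (y ∘ suc) t) ⟩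
  y zero * (t * prodOver S (y ∘ suc))
    ≡⟨ *-left-comm (y zero) t (prodOver S (y ∘ suc)) ⟩
  t * (y zero * prodOver S (y ∘ suc))
    ∎
  where
  open ≡-Reasoning
  *-left-comm : ∀ a b c → a * (b * c) ≡ b * (a * c)
  *-left-comm = solve 3 (λ a b c → a :* (b :* c) := b :* (a :* c)) refl
prodOver-insertAt-true (suc i) (false ∷ S) y t = prodOver-insertAt-true i S (y ∘ suc) t

insertAt-pointwise : ∀ {A : Set} {n} (P : A → Set) (xs : Fin n → A) (i : Fin (suc n)) (x : A) →
  (∀ c → P (xs c)) → P x → ∀ c → P (Vector.insertAt xs i x c)
insertAt-pointwise         P xs zero    x Pxs Px zero    = Px
insertAt-pointwise         P xs zero    x Pxs Px (suc c) = Pxs c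
insertAt-pointwise {n = suc n} P xs (suc i) x Pxs Px zero    = Pxs zero
insertAt-pointwise {n = suc n} P xs (suc i) x Pxs Px (suc c) =
  insertAt-pointwise P (xs ∘ suc) i x (Pxs ∘ suc) Px c

-- polyM, ΔM and Rayleigh for an arbitrary basis family, since minors are defined on families;
-- for a matroid M they are definitionally those of isBasis M.

basisTerm : ∀ {n} → Family n → (I J : Subset n) → (Fin n → ℚ) → Subset n → ℚ
basisTerm β I J y B = if β B ∧ (I ⊆ᵇ B) ∧ disjointᵇ B J then prodOver (B ─ I) y else 0ℚ

basisPoly : ∀ {n} → Family n → (I J : Subset n) → (Fin n → ℚ) → ℚ
basisPoly {n} β I J y = sumOver (allSubsets n) (basisTerm β I J y)

ΔBasis : ∀ {n} → Family n → (e f : Fin n) → (Fin n → ℚ) → ℚ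
ΔBasis β e f y =
  basisPoly β ⁅ e ⁆ ⁅ f ⁆ y * basisPoly β ⁅ f ⁆ ⁅ e ⁆ y
  - basisPoly β (⁅ e ⁆ ∪ ⁅ f ⁆) ⊥ y * basisPoly β ⊥ (⁅ e ⁆ ∪ ⁅ f ⁆) y

RayleighFamily : ∀ {n} → Family n → Set
RayleighFamily {n} β = ∀ (e f : Fin n) → e ≢ f → ∀ (y : Fin n → ℚ) →
  (∀ c → 0ℚ < y c) → 0ℚ ≤ ΔBasis β e f y

avoiding : ∀ {n} → Family (suc n) → Fin (suc n) → Family n
avoiding β i S = β (insertAt S i false)

containing : ∀ {n} → Family (suc n) → Fin (suc n) → Family n
containing β i S = β (insertAt S i true)

basisTerm-insertAt : ∀ {n} (β : Family (suc n)) i (I J S : Subset n) b t y →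
  basisTerm β (insertAt I i false) (insertAt J i false) (Vector.insertAt y i t) (insertAt S i b)
    ≡ (if β (insertAt S i b) ∧ (I ⊆ᵇ S) ∧ disjointᵇ S J
       then prodOver (insertAt (S ─ I) i b) (Vector.insertAt y i t) else 0ℚ)
basisTerm-insertAt β i I J S b t y
  rewrite ⊆ᵇ-insertAt i I S b | disjointᵇ-insertAt i S J b | ─-insertAt i S I b = refl

if-then-*ˡ : ∀ (c : Bool) t p → (if c then t * p else 0ℚ) ≡ t * (if c then p else 0ℚ)
if-then-*ˡ true  t p = refl
if-then-*ˡ false t p = sym (*-zeroʳ t)

basisPoly-insertAt : ∀ {n} (β : Family (suc n)) i (I J : Subset n) t y →
  basisPoly β (insertAt I i false) (insertAt J i false) (Vector.insertAt y i t)
    ≡ basisPoly (avoiding β i) I J y + t * basisPoly (containing β i) I J y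
basisPoly-insertAt {n} β i I J t y =
  trans (sumOver-allSubsets-insertAt i _)
        (cong₂ _+_ (sumOver-cong (allSubsets n) termAvoiding)
                   (trans (sumOver-cong (allSubsets n) termContaining) (sumOver-*ˡ t (allSubsets n) _)))
  where
  I′ = insertAt I i false
  J′ = insertAt J i false
  y′ = Vector.insertAt y i t
  termAvoiding : ∀ S → basisTerm β I′ J′ y′ (insertAt S i false) ≡ basisTerm (avoiding β i) I J y S
  termAvoiding S =
    trans (basisTerm-insertAt β i I J S false t y)
          (cong (λ p → if _ then p else 0ℚ) (prodOver-insertAt-false i (S ─ I) y t))
  termContaining : ∀ S →
    basisTerm β I′ J′ y′ (insertAt S i true) ≡ t * basisTerm (containing β i) I J y S
  termContaining S =
    trans (basisTerm-insertAt β i I J S true t y)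
          (trans (cong (λ p → if _ then p else 0ℚ) (prodOver-insertAt-true i (S ─ I) y t))
                 (if-then-*ˡ _ t _))

ΔBasis-insertAt : ∀ {n} (β : Family (suc n)) i (e f : Fin n) t y →
  let P = λ I J → basisPoly (avoiding β i) I J y
      Q = λ I J → basisPoly (containing β i) I J y
      ef = ⁅ e ⁆ ∪ ⁅ f ⁆ in
  ΔBasis β (punchIn i e) (punchIn i f) (Vector.insertAt y i t)
    ≡ (P ⁅ e ⁆ ⁅ f ⁆ + t * Q ⁅ e ⁆ ⁅ f ⁆) * (P ⁅ f ⁆ ⁅ e ⁆ + t * Q ⁅ f ⁆ ⁅ e ⁆)
      - (P ef ⊥ + t * Q ef ⊥) * (P ⊥ ef + t * Q ⊥ ef)
ΔBasis-insertAt {n} β i e f t y =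
  cong₂ _-_ (cong₂ _*_ (lifted (⁅punchIn⁆ i e) (⁅punchIn⁆ i f))
                       (lifted (⁅punchIn⁆ i f) (⁅punchIn⁆ i e)))
            (cong₂ _*_ (lifted ef-lift ⊥-lift) (lifted ⊥-lift ef-lift))
  where
  lifted : ∀ {I J I′ J′} → I′ ≡ insertAt I i false → J′ ≡ insertAt J i false →
    basisPoly β I′ J′ (Vector.insertAt y i t)
      ≡ basisPoly (avoiding β i) I J y + t * basisPoly (containing β i) I J y
  lifted {I} {J} refl refl = basisPoly-insertAt β i I J t y
  ef-lift : ⁅ punchIn i e ⁆ ∪ ⁅ punchIn i f ⁆ ≡ insertAt (⁅ e ⁆ ∪ ⁅ f ⁆) i false
  ef-lift = trans (cong₂ _∪_ (⁅punchIn⁆ i e) (⁅punchIn⁆ i f))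
                  (zipWith-insertAt _ ⁅ e ⁆ ⁅ f ⁆ i false false)
  ⊥-lift : ⊥ ≡ insertAt ⊥ i false
  ⊥-lift = sym (replicate-insertAt n false i)

Rayleigh-avoiding×containing : ∀ {n} (β : Family (suc n)) i → RayleighFamily β →
  RayleighFamily (avoiding β i) × RayleighFamily (containing β i)
Rayleigh-avoiding×containing β i ray =
  (λ e f e≢f y 0<y → proj₁ (ends e f e≢f y 0<y)) , (λ e f e≢f y 0<y → proj₂ (ends e f e≢f y 0<y))
  where
  ends : ∀ e f → e ≢ f → ∀ y → (∀ c → 0ℚ < y c) →
    0ℚ ≤ ΔBasis (avoiding β i) e f y × 0ℚ ≤ ΔBasis (containing β i) e f y
  ends e f e≢f y 0<y =
    0≤pencil⇒0≤ends (P ⁅ e ⁆ ⁅ f ⁆) (P ⁅ f ⁆ ⁅ e ⁆) (P ef ⊥) (P ⊥ ef)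
                    (Q ⁅ e ⁆ ⁅ f ⁆) (Q ⁅ f ⁆ ⁅ e ⁆) (Q ef ⊥) (Q ⊥ ef) λ t 0<t →
      subst (0ℚ ≤_) (ΔBasis-insertAt β i e f t y)
        (ray (punchIn i e) (punchIn i f) (e≢f ∘ punchIn-injective i e f) (Vector.insertAt y i t)
             (insertAt-pointwise (0ℚ <_) y i t 0<y 0<t))
    where
    P Q : Subset _ → Subset _ → ℚ
    P I J = basisPoly (avoiding β i) I J y
    Q I J = basisPoly (containing β i) I J y
    ef = ⁅ e ⁆ ∪ ⁅ f ⁆

Rayleigh-if : ∀ {n} (b : Bool) {α γ : Family n} → RayleighFamily α → RayleighFamily γ →
  RayleighFamily (λ S → if b then α S else γ S)
Rayleigh-if true  rayα rayγ = rayα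
Rayleigh-if false rayα rayγ = rayγ

Rayleigh-delete : ∀ {n} (β : Family (suc n)) i → RayleighFamily β → RayleighFamily (delete β i)
Rayleigh-delete {n} β i ray =
  Rayleigh-if (anyᴸ (λ B → β B ∧ not (lookup B i)) (allSubsets (suc n))) (proj₁ split) (proj₂ split)
  where split = Rayleigh-avoiding×containing β i ray

Rayleigh-contract : ∀ {n} (β : Family (suc n)) i → RayleighFamily β → RayleighFamily (contract β i)
Rayleigh-contract {n} β i ray =
  Rayleigh-if (anyᴸ (λ B → β B ∧ lookup B i) (allSubsets (suc n))) (proj₂ split) (proj₁ split)
  where split = Rayleigh-avoiding×containing β i ray

Rayleigh-cong : ∀ {n} {β′ β : Family n} → (∀ S → β′ S ≡ β S) → RayleighFamily β → RayleighFamily β′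
Rayleigh-cong {n} {β′} {β} β′≗β ray e f e≢f y 0<y =
  subst (0ℚ ≤_) (sym (cong₂ _-_ (cong₂ _*_ poly-cong poly-cong) (cong₂ _*_ poly-cong poly-cong)))
        (ray e f e≢f y 0<y)
  where
  poly-cong : ∀ {I J} → basisPoly β′ I J y ≡ basisPoly β I J y
  poly-cong {I} {J} = sumOver-cong (allSubsets n)
    (λ S → cong (λ b → if b ∧ (I ⊆ᵇ S) ∧ disjointᵇ S J then prodOver (S ─ I) y else 0ℚ) (β′≗β S))

Rayleigh-minor : ∀ {m n} {β′ : Family m} {β : Family n} →
  IsMinorFam β′ β → RayleighFamily β → RayleighFamily β′
Rayleigh-minor (here β′≗β)       ray = Rayleigh-cong β′≗β ray
Rayleigh-minor {β = β} (del i minor) ray = Rayleigh-minor minor (Rayleigh-delete β i ray)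
Rayleigh-minor {β = β} (con i minor) ray = Rayleigh-minor minor (Rayleigh-contract β i ray)

proposition3p2 : ∀ {m n : ℕ} (M : Matroid m) (N : Matroid n) →
    Rayleigh M → IsMinor N M → Rayleigh N
proposition3p2 M N ray minor = Rayleigh-minor minor ray
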